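{- Let $q\in\mathbb{C}^\times$ and let $\mathbb{C}_q[X,Y]$ be the unital associative algebra over $\mathbb{C}$ generated by $X,Y$ subject to $YX=qXY$. Then for all $m,n\in\mathbb{N}_0$, in $\mathbb{C}_q[X,Y]$, \begin{align*} (X+Y)^{m+n+1} &= Y^{n+1} \sum_{k=0}^{m}\begin{bmatrix}n+k\\k\end{bmatrix}_q q^{ -(n+1)k}\,X^k (X+Y)^{m-k}\\ &\quad+X^{m+1} \sum_{k=0}^n \begin{bmatrix}m+k\\k\end{bmatrix}_{q^{ -1}} q^{(m+1)k}\, Y^k (X+Y)^{n-k}. \end{align*}
   Context: $(x;q)_0:=1$, $(x;q)_k:=\prod_{\ell=0}^{k-1}(1-xq^\ell)$. The $q$-binomial coefficient is $\begin{bmatrix}n\\k\end{bmatrix}_q:=\frac{(q;q)_n}{(q;q)_k(q;q)_{n-k}}$ for $0\le k\le n$ (as rational functions of $q$, evaluated at the given $q$, resp. $q^{ -1}$). -}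

module Defs where

open import Level using (Level)
open import Data.Nat using (ℕ; zero; suc; _+_; _*_; _∸_)
open import Algebra.Bundles using (Ring)

module RingDefs {c ℓ : Level} (R : Ring c ℓ) where
  open Ring R public renaming (_+_ to _⊕_; _*_ to _⊛_)

  pow : Carrier → ℕ → Carrier
  pow x zero    = 1#
  pow x (suc n) = x ⊛ pow x n

  sumTo : ℕ → (ℕ → Carrier) → Carrier
  sumTo zero    f = f 0
  sumTo (suc m) f = sumTo m f ⊕ f (suc m)

  -- Gaussian binomial coefficient [n choose k]_t, evaluated at t ∈ R,
  -- i.e. the polynomial (t;t)_n / ((t;t)_k (t;t)_{n-k}) (0 for k > n),
  -- computed by the q-Pascal rule [n+1,k+1] = [n,k] + t^(k+1) [n,k+1].
  qbin : Carrier → ℕ → ℕ → Carrier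
  qbin t n       zero    = 1#
  qbin t zero    (suc k) = 0#
  qbin t (suc n) (suc k) = qbin t n k ⊕ (pow t (suc k) ⊛ qbin t n (suc k))

-- Write S = X + Y and let A(m, n) be the first summand on the right. Expanding
-- S·S^(m+n+1) as X·S^(m+n+1) + Y·S^(m+n+1) and using induction on both indices,
-- the identity reduces to the recurrence X·A(m, n+1) + Y·A(m+1, n) = A(m+1, n+1)
-- and its mirror image for the second summand (X ↔ Y, q ↔ q⁻¹). Moving X past
-- Y^(n+2) costs q^-(n+2), so coefficientwise the recurrence is the q-Pascal rule
-- [n+k+2, k+1] = [n+k+1, k] + q^(k+1) [n+k+1, k+1], rescaled by q^-(n+2)(k+1).
-- The boundary cases are A(0, n) = Y^(n+1) and S^(m+1) = A(m, 0) + X^(m+1).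
module Submission where

open import Defs
open import Level using (Level)
open import Data.Nat using (ℕ; zero; suc; _+_; _*_; _∸_; _<_; s≤s)
import Data.Nat.Properties as ℕ
open import Algebra.Bundles using (Ring)
import Relation.Binary.PropositionalEquality as ≡
open ≡ using (_≡_)

module RingLemmas {c ℓ : Level} (R : Ring c ℓ) where
  open RingDefs R
  open import Relation.Binary.Reasoning.Setoid setoid
  open import Algebra.Properties.Semiring.Exp semiring using (_^_; ^-homo-*)
  open import Algebra.Properties.Semigroup *-semigroup using (uv∙wx≈u[vw∙x]; [u∙vw]x≈u[v∙wx])
  open import Algebra.Properties.CommutativeSemigroup +-commutativeSemigroup
    using (interchange; x∙yz≈y∙xz; xy∙z≈xz∙y)

  pow-congʳ : ∀ x {m n} → m ≡ n → pow x m ≈ pow x n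
  pow-congʳ x m≡n = reflexive (≡.cong (pow x) m≡n)

  pow≡^ : ∀ x n → pow x n ≡ x ^ n
  pow≡^ x zero    = ≡.refl
  pow≡^ x (suc n) = ≡.cong (x ⊛_) (pow≡^ x n)

  pow-+ : ∀ x m n → pow x (m + n) ≈ pow x m ⊛ pow x n
  pow-+ x m n rewrite pow≡^ x (m + n) | pow≡^ x m | pow≡^ x n = ^-homo-* x m n

  Central : Carrier → Set (c Level.⊔ ℓ)
  Central a = ∀ z → a ⊛ z ≈ z ⊛ a

  central-1 : Central 1#
  central-1 z = trans (*-identityˡ z) (sym (*-identityʳ z))

  central-0 : Central 0#
  central-0 z = trans (zeroˡ z) (sym (zeroʳ z))

  central-* : ∀ {a b} → Central a → Central b → Central (a ⊛ b)
  central-* {a} {b} a-central b-central z = begin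
    (a ⊛ b) ⊛ z ≈⟨ *-assoc a b z ⟩
    a ⊛ (b ⊛ z) ≈⟨ *-congˡ (b-central z) ⟩
    a ⊛ (z ⊛ b) ≈⟨ *-assoc a z b ⟨
    (a ⊛ z) ⊛ b ≈⟨ *-congʳ (a-central z) ⟩
    (z ⊛ a) ⊛ b ≈⟨ *-assoc z a b ⟩
    z ⊛ (a ⊛ b) ∎

  central-+ : ∀ {a b} → Central a → Central b → Central (a ⊕ b)
  central-+ {a} {b} a-central b-central z = begin
    (a ⊕ b) ⊛ z   ≈⟨ distribʳ z a b ⟩
    a ⊛ z ⊕ b ⊛ z ≈⟨ +-cong (a-central z) (b-central z) ⟩
    z ⊛ a ⊕ z ⊛ b ≈⟨ distribˡ z a b ⟨
    z ⊛ (a ⊕ b)   ∎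

  central-pow : ∀ {a} → Central a → ∀ n → Central (pow a n)
  central-pow a-central zero    = central-1
  central-pow a-central (suc n) = central-* a-central (central-pow a-central n)

  central-qbin : ∀ {t} → Central t → ∀ n k → Central (qbin t n k)
  central-qbin t-central n       zero    = central-1
  central-qbin t-central zero    (suc k) = central-0
  central-qbin t-central (suc n) (suc k) =
    central-+ (central-qbin t-central n k)
              (central-* (central-pow t-central (suc k)) (central-qbin t-central n (suc k)))

  central-swap : ∀ {a} → Central a → ∀ x y → x ⊛ (a ⊛ y) ≈ a ⊛ (x ⊛ y)
  central-swap {a} a-central x y = begin
    x ⊛ (a ⊛ y) ≈⟨ *-assoc x a y ⟨
    (x ⊛ a) ⊛ y ≈⟨ *-congʳ (a-central x) ⟨
    (a ⊛ x) ⊛ y ≈⟨ *-assoc a x y ⟩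
    a ⊛ (x ⊛ y) ∎

  inverse-central : ∀ {a b} → a ⊛ b ≈ 1# → b ⊛ a ≈ 1# → Central a → Central b
  inverse-central {a} {b} ab≈1 ba≈1 a-central z = begin
    b ⊛ z               ≈⟨ *-identityʳ (b ⊛ z) ⟨
    (b ⊛ z) ⊛ 1#        ≈⟨ *-congˡ ab≈1 ⟨
    (b ⊛ z) ⊛ (a ⊛ b)   ≈⟨ uv∙wx≈u[vw∙x] b z a b ⟩
    b ⊛ ((z ⊛ a) ⊛ b)   ≈⟨ *-congˡ (*-congʳ (a-central z)) ⟨
    b ⊛ ((a ⊛ z) ⊛ b)   ≈⟨ uv∙wx≈u[vw∙x] b a z b ⟨
    (b ⊛ a) ⊛ (z ⊛ b)   ≈⟨ *-congʳ ba≈1 ⟩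
    1# ⊛ (z ⊛ b)        ≈⟨ *-identityˡ (z ⊛ b) ⟩
    z ⊛ b               ∎

  inverse-cancel : ∀ {a b} → a ⊛ b ≈ 1# → Central b → ∀ x y → (a ⊛ x) ⊛ (b ⊛ y) ≈ x ⊛ y
  inverse-cancel {a} {b} ab≈1 b-central x y = begin
    (a ⊛ x) ⊛ (b ⊛ y) ≈⟨ *-assoc a x (b ⊛ y) ⟩
    a ⊛ (x ⊛ (b ⊛ y)) ≈⟨ *-congˡ (central-swap b-central x y) ⟩
    a ⊛ (b ⊛ (x ⊛ y)) ≈⟨ *-assoc a b (x ⊛ y) ⟨
    (a ⊛ b) ⊛ (x ⊛ y) ≈⟨ *-congʳ ab≈1 ⟩
    1# ⊛ (x ⊛ y)      ≈⟨ *-identityˡ (x ⊛ y) ⟩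
    x ⊛ y             ∎

  pow-inverse : ∀ {t t'} → t ⊛ t' ≈ 1# → Central t' → ∀ n → pow t n ⊛ pow t' n ≈ 1#
  pow-inverse tt'≈1 t'-central zero    = *-identityˡ 1#
  pow-inverse tt'≈1 t'-central (suc n) =
    trans (inverse-cancel tt'≈1 t'-central _ _) (pow-inverse tt'≈1 t'-central n)

  flip-commutation : ∀ {t t' x y} → t' ⊛ t ≈ 1# → y ⊛ x ≈ t ⊛ (x ⊛ y) → x ⊛ y ≈ t' ⊛ (y ⊛ x)
  flip-commutation {t} {t'} {x} {y} t't≈1 yx≈txy = sym (begin
    t' ⊛ (y ⊛ x)        ≈⟨ *-congˡ yx≈txy ⟩
    t' ⊛ (t ⊛ (x ⊛ y))  ≈⟨ *-assoc t' t (x ⊛ y) ⟨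
    (t' ⊛ t) ⊛ (x ⊛ y)  ≈⟨ *-congʳ t't≈1 ⟩
    1# ⊛ (x ⊛ y)        ≈⟨ *-identityˡ (x ⊛ y) ⟩
    x ⊛ y               ∎)

  commute-past-pow : ∀ {t x y} → Central t → x ⊛ y ≈ t ⊛ (y ⊛ x) →
                     ∀ n z → x ⊛ (pow y n ⊛ z) ≈ pow y n ⊛ (pow t n ⊛ (x ⊛ z))
  commute-past-pow {t} {x} {y} t-central xy≈tyx zero z =
    trans (*-congˡ (*-identityˡ z)) (sym (trans (*-identityˡ _) (*-identityˡ _)))
  commute-past-pow {t} {x} {y} t-central xy≈tyx (suc n) z = begin
    x ⊛ ((y ⊛ yⁿ) ⊛ z)                ≈⟨ *-congˡ (*-assoc y yⁿ z) ⟩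
    x ⊛ (y ⊛ (yⁿ ⊛ z))                ≈⟨ *-assoc x y (yⁿ ⊛ z) ⟨
    (x ⊛ y) ⊛ (yⁿ ⊛ z)                ≈⟨ *-congʳ xy≈tyx ⟩
    (t ⊛ (y ⊛ x)) ⊛ (yⁿ ⊛ z)          ≈⟨ [u∙vw]x≈u[v∙wx] t y x (yⁿ ⊛ z) ⟩
    t ⊛ (y ⊛ (x ⊛ (yⁿ ⊛ z)))          ≈⟨ *-congˡ (*-congˡ (commute-past-pow t-central xy≈tyx n z)) ⟩
    t ⊛ (y ⊛ (yⁿ ⊛ (tⁿ ⊛ (x ⊛ z))))   ≈⟨ central-swap t-central y _ ⟨
    y ⊛ (t ⊛ (yⁿ ⊛ (tⁿ ⊛ (x ⊛ z))))   ≈⟨ *-congˡ (central-swap t-central yⁿ _) ⟨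
    y ⊛ (yⁿ ⊛ (t ⊛ (tⁿ ⊛ (x ⊛ z))))   ≈⟨ *-assoc y yⁿ _ ⟨
    (y ⊛ yⁿ) ⊛ (t ⊛ (tⁿ ⊛ (x ⊛ z)))   ≈⟨ *-congˡ (*-assoc t tⁿ (x ⊛ z)) ⟨
    (y ⊛ yⁿ) ⊛ ((t ⊛ tⁿ) ⊛ (x ⊛ z))   ∎
    where
    yⁿ = pow y n
    tⁿ = pow t n

  k>n⇒qbin≈0 : ∀ t {n k} → n < k → qbin t n k ≈ 0#
  k>n⇒qbin≈0 t {zero}  {suc k} n<k         = refl
  k>n⇒qbin≈0 t {suc n} {suc k} (s≤s n<k) = begin
    qbin t n k ⊕ pow t (suc k) ⊛ qbin t n (suc k)
      ≈⟨ +-cong (k>n⇒qbin≈0 t n<k) (*-congˡ (k>n⇒qbin≈0 t (ℕ.m<n⇒m<1+n n<k))) ⟩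
    0# ⊕ pow t (suc k) ⊛ 0#  ≈⟨ +-identityˡ _ ⟩
    pow t (suc k) ⊛ 0#       ≈⟨ zeroʳ _ ⟩
    0#                       ∎

  qbin-nn≈1 : ∀ t n → qbin t n n ≈ 1#
  qbin-nn≈1 t zero    = refl
  qbin-nn≈1 t (suc n) = begin
    qbin t n n ⊕ pow t (suc n) ⊛ qbin t n (suc n)
      ≈⟨ +-cong (qbin-nn≈1 t n) (*-congˡ (k>n⇒qbin≈0 t (ℕ.n<1+n n))) ⟩
    1# ⊕ pow t (suc n) ⊛ 0#  ≈⟨ +-congˡ (zeroʳ _) ⟩
    1# ⊕ 0#                  ≈⟨ +-identityʳ 1# ⟩
    1#                       ∎

  sumTo-cong : ∀ {f g} → (∀ k → f k ≈ g k) → ∀ m → sumTo m f ≈ sumTo m g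
  sumTo-cong f≈g zero    = f≈g 0
  sumTo-cong f≈g (suc m) = +-cong (sumTo-cong f≈g m) (f≈g (suc m))

  sumTo-+ : ∀ f g m → sumTo m f ⊕ sumTo m g ≈ sumTo m (λ k → f k ⊕ g k)
  sumTo-+ f g zero    = refl
  sumTo-+ f g (suc m) = trans (interchange _ _ _ _) (+-congʳ (sumTo-+ f g m))

  *-distribˡ-sumTo : ∀ a f m → a ⊛ sumTo m f ≈ sumTo m (λ k → a ⊛ f k)
  *-distribˡ-sumTo a f zero    = refl
  *-distribˡ-sumTo a f (suc m) = trans (distribˡ a _ _) (+-congʳ (*-distribˡ-sumTo a f m))

  sumTo-head : ∀ f m → sumTo (suc m) f ≈ f 0 ⊕ sumTo m (λ k → f (suc k))
  sumTo-head f zero    = refl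
  sumTo-head f (suc m) = trans (+-congʳ (sumTo-head f m)) (+-assoc _ _ _)

  sumTo-shifted-+ : ∀ {f g h} → h 0 ≈ g 0 → (∀ k → f k ⊕ g (suc k) ≈ h (suc k)) →
                    ∀ m → sumTo m f ⊕ sumTo (suc m) g ≈ sumTo (suc m) h
  sumTo-shifted-+ {f} {g} {h} h0≈g0 f+g≈h m = begin
    sumTo m f ⊕ sumTo (suc m) g
      ≈⟨ +-congˡ (sumTo-head g m) ⟩
    sumTo m f ⊕ (g 0 ⊕ sumTo m (λ k → g (suc k)))
      ≈⟨ x∙yz≈y∙xz _ _ _ ⟩
    g 0 ⊕ (sumTo m f ⊕ sumTo m (λ k → g (suc k)))
      ≈⟨ +-cong (sym h0≈g0) (trans (sumTo-+ f _ m) (sumTo-cong f+g≈h m)) ⟩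
    h 0 ⊕ sumTo m (λ k → h (suc k))
      ≈⟨ sumTo-head h m ⟨
    sumTo (suc m) h ∎

  weight : Carrier → Carrier → ℕ → ℕ → Carrier
  weight t t' n k = qbin t (n + k) k ⊛ pow t' ((n + 1) * k)

  central-weight : ∀ {t t'} → Central t → Central t' → ∀ n k → Central (weight t t' n k)
  central-weight t-central t'-central n k =
    central-* (central-qbin t-central (n + k) k) (central-pow t'-central ((n + 1) * k))

  weight-zero : ∀ t t' k → weight t t' 0 k ≈ pow t' k
  weight-zero t t' k = begin
    qbin t k k ⊛ pow t' (1 * k) ≈⟨ *-cong (qbin-nn≈1 t k) (pow-congʳ t' (ℕ.*-identityˡ k)) ⟩
    1# ⊛ pow t' k               ≈⟨ *-identityˡ _ ⟩
    pow t' k                    ∎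

  weight-zero-suc : ∀ t t' k → pow t' 1 ⊛ weight t t' 0 k ≈ weight t t' 0 (suc k)
  weight-zero-suc t t' k = begin
    pow t' 1 ⊛ weight t t' 0 k ≈⟨ *-congˡ (weight-zero t t' k) ⟩
    pow t' 1 ⊛ pow t' k        ≈⟨ pow-+ t' 1 k ⟨
    pow t' (suc k)             ≈⟨ weight-zero t t' (suc k) ⟨
    weight t t' 0 (suc k)      ∎

  -- The q-Pascal rule defining qbin, rescaled by t'^((n+2)(k+1)).
  weight-pascal : ∀ {t t'} → t ⊛ t' ≈ 1# → Central t' → ∀ n k →
    pow t' (suc n + 1) ⊛ weight t t' (suc n) k ⊕ weight t t' n (suc k) ≈ weight t t' (suc n) (suc k)
  weight-pascal {t} {t'} tt'≈1 t'-central n k = sym (begin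
    (qbin t (n + suc k) k ⊕ pow t (suc k) ⊛ c₂) ⊛ pow t' (suc n₂ * suc k)
      ≈⟨ distribʳ _ _ _ ⟩
    qbin t (n + suc k) k ⊛ pow t' (suc n₂ * suc k) ⊕ (pow t (suc k) ⊛ c₂) ⊛ pow t' (suc n₂ * suc k)
      ≈⟨ +-cong first second ⟩
    pow t' (suc n₂) ⊛ weight t t' (suc n) k ⊕ weight t t' n (suc k) ∎)
    where
    n₂ = n + 1
    c₁ = qbin t (suc n + k) k
    c₂ = qbin t (n + suc k) (suc k)
    first : qbin t (n + suc k) k ⊛ pow t' (suc n₂ * suc k) ≈ pow t' (suc n₂) ⊛ (c₁ ⊛ pow t' (suc n₂ * k))
    first = begin
      qbin t (n + suc k) k ⊛ pow t' (suc n₂ * suc k)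
        ≈⟨ *-cong (reflexive (≡.cong (λ j → qbin t j k) (ℕ.+-suc n k))) (pow-congʳ t' (ℕ.*-suc (suc n₂) k)) ⟩
      c₁ ⊛ pow t' (suc n₂ + suc n₂ * k)           ≈⟨ *-congˡ (pow-+ t' (suc n₂) _) ⟩
      c₁ ⊛ (pow t' (suc n₂) ⊛ pow t' (suc n₂ * k)) ≈⟨ central-swap (central-pow t'-central (suc n₂)) _ _ ⟩
      pow t' (suc n₂) ⊛ (c₁ ⊛ pow t' (suc n₂ * k)) ∎
    second : (pow t (suc k) ⊛ c₂) ⊛ pow t' (suc n₂ * suc k) ≈ c₂ ⊛ pow t' (n₂ * suc k)
    second = begin
      (pow t (suc k) ⊛ c₂) ⊛ pow t' (suc k + n₂ * suc k)
        ≈⟨ *-congˡ (pow-+ t' (suc k) _) ⟩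
      (pow t (suc k) ⊛ c₂) ⊛ (pow t' (suc k) ⊛ pow t' (n₂ * suc k))
        ≈⟨ inverse-cancel (pow-inverse tt'≈1 t'-central (suc k)) (central-pow t'-central (suc k)) _ _ ⟩
      c₂ ⊛ pow t' (n₂ * suc k) ∎

  -- half m n is the first summand of the theorem, and the second is half n m of the
  -- instance with (X, q) and (Y, q') swapped; S is only required to equal X + Y
  -- so that both instances can use the same S.
  module Expansion (q q' X Y S : Carrier) (qq'≈1 : q ⊛ q' ≈ 1#)
                   (q-central : Central q) (q'-central : Central q')
                   (XY≈q'YX : X ⊛ Y ≈ q' ⊛ (Y ⊛ X)) (S≈X+Y : S ≈ X ⊕ Y) where

    term : ℕ → ℕ → ℕ → Carrier
    term n m k = qbin q (n + k) k ⊛ (pow q' ((n + 1) * k) ⊛ (pow X k ⊛ pow S (m ∸ k)))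

    half : ℕ → ℕ → Carrier
    half m n = pow Y (n + 1) ⊛ sumTo m (term n m)

    term≈weight : ∀ n m k → term n m k ≈ weight q q' n k ⊛ (pow X k ⊛ pow S (m ∸ k))
    term≈weight n m k = sym (*-assoc _ _ _)

    scaled-X-term : ∀ a n m k →
      a ⊛ (X ⊛ term n m k) ≈ (a ⊛ weight q q' n k) ⊛ (pow X (suc k) ⊛ pow S (m ∸ k))
    scaled-X-term a n m k = begin
      a ⊛ (X ⊛ term n m k)                     ≈⟨ *-congˡ (*-congˡ (term≈weight n m k)) ⟩
      a ⊛ (X ⊛ (w ⊛ (pow X k ⊛ pow S (m ∸ k)))) ≈⟨ *-congˡ (central-swap w-central X _) ⟩
      a ⊛ (w ⊛ (X ⊛ (pow X k ⊛ pow S (m ∸ k)))) ≈⟨ *-congˡ (*-congˡ (*-assoc X _ _)) ⟨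
      a ⊛ (w ⊛ (pow X (suc k) ⊛ pow S (m ∸ k))) ≈⟨ *-assoc a w _ ⟨
      (a ⊛ w) ⊛ (pow X (suc k) ⊛ pow S (m ∸ k)) ∎
      where
      w = weight q q' n k
      w-central = central-weight q-central q'-central n k

    term-pascal : ∀ n m k →
      pow q' (suc n + 1) ⊛ (X ⊛ term (suc n) m k) ⊕ term n (suc m) (suc k) ≈ term (suc n) (suc m) (suc k)
    term-pascal n m k = begin
      pow q' (suc n + 1) ⊛ (X ⊛ term (suc n) m k) ⊕ term n (suc m) (suc k)
        ≈⟨ +-cong (scaled-X-term _ (suc n) m k) (term≈weight n (suc m) (suc k)) ⟩
      (pow q' (suc n + 1) ⊛ weight q q' (suc n) k) ⊛ W ⊕ weight q q' n (suc k) ⊛ W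
        ≈⟨ distribʳ W _ _ ⟨
      (pow q' (suc n + 1) ⊛ weight q q' (suc n) k ⊕ weight q q' n (suc k)) ⊛ W
        ≈⟨ *-congʳ (weight-pascal qq'≈1 q'-central n k) ⟩
      weight q q' (suc n) (suc k) ⊛ W
        ≈⟨ term≈weight (suc n) (suc m) (suc k) ⟨
      term (suc n) (suc m) (suc k) ∎
      where
      W = pow X (suc k) ⊛ pow S (m ∸ k)

    term-zero-suc : ∀ m k → pow q' 1 ⊛ (X ⊛ term 0 m k) ≈ term 0 (suc m) (suc k)
    term-zero-suc m k = begin
      pow q' 1 ⊛ (X ⊛ term 0 m k)                                    ≈⟨ scaled-X-term _ 0 m k ⟩
      (pow q' 1 ⊛ weight q q' 0 k) ⊛ (pow X (suc k) ⊛ pow S (m ∸ k)) ≈⟨ *-congʳ (weight-zero-suc q q' k) ⟩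
      weight q q' 0 (suc k) ⊛ (pow X (suc k) ⊛ pow S (m ∸ k))        ≈⟨ term≈weight 0 (suc m) (suc k) ⟨
      term 0 (suc m) (suc k)                                         ∎

    term-head : ∀ n m → term n m 0 ≈ pow S m
    term-head n m = begin
      1# ⊛ (pow q' ((n + 1) * 0) ⊛ (1# ⊛ pow S m)) ≈⟨ *-identityˡ _ ⟩
      pow q' ((n + 1) * 0) ⊛ (1# ⊛ pow S m)        ≈⟨ *-cong (pow-congʳ q' (ℕ.*-zeroʳ (n + 1))) (*-identityˡ _) ⟩
      1# ⊛ pow S m                                ≈⟨ *-identityˡ _ ⟩
      pow S m                                     ∎

    half-zero : ∀ n → half 0 n ≈ pow Y (suc n)
    half-zero n = begin
      pow Y (n + 1) ⊛ term n 0 0 ≈⟨ *-congˡ (term-head n 0) ⟩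
      pow Y (n + 1) ⊛ 1#         ≈⟨ *-identityʳ _ ⟩
      pow Y (n + 1)              ≈⟨ pow-congʳ Y (ℕ.+-comm n 1) ⟩
      pow Y (suc n)              ∎

    X-half : ∀ m n → X ⊛ half m n ≈ pow Y (n + 1) ⊛ sumTo m (λ k → pow q' (n + 1) ⊛ (X ⊛ term n m k))
    X-half m n = begin
      X ⊛ (pow Y (n + 1) ⊛ sumTo m (term n m))
        ≈⟨ commute-past-pow q'-central XY≈q'YX (n + 1) _ ⟩
      pow Y (n + 1) ⊛ (pow q' (n + 1) ⊛ (X ⊛ sumTo m (term n m)))
        ≈⟨ *-congˡ (*-congˡ (*-distribˡ-sumTo X _ m)) ⟩
      pow Y (n + 1) ⊛ (pow q' (n + 1) ⊛ sumTo m (λ k → X ⊛ term n m k))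
        ≈⟨ *-congˡ (*-distribˡ-sumTo _ _ m) ⟩
      pow Y (n + 1) ⊛ sumTo m (λ k → pow q' (n + 1) ⊛ (X ⊛ term n m k)) ∎

    half-step : ∀ m n → X ⊛ half m (suc n) ⊕ Y ⊛ half (suc m) n ≈ half (suc m) (suc n)
    half-step m n = begin
      X ⊛ half m (suc n) ⊕ Y ⊛ (pow Y (n + 1) ⊛ sumTo (suc m) (term n (suc m)))
        ≈⟨ +-cong (X-half m (suc n)) (sym (*-assoc Y _ _)) ⟩
      pow Y (suc n + 1) ⊛ sumTo m (λ k → pow q' (suc n + 1) ⊛ (X ⊛ term (suc n) m k))
        ⊕ pow Y (suc n + 1) ⊛ sumTo (suc m) (term n (suc m))
        ≈⟨ distribˡ _ _ _ ⟨
      pow Y (suc n + 1) ⊛ (sumTo m (λ k → pow q' (suc n + 1) ⊛ (X ⊛ term (suc n) m k))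
                            ⊕ sumTo (suc m) (term n (suc m)))
        ≈⟨ *-congˡ (sumTo-shifted-+ refl (term-pascal n m) m) ⟩
      half (suc m) (suc n) ∎

    half-base-step : ∀ m → X ⊛ half m 0 ⊕ Y ⊛ pow S (suc m) ≈ half (suc m) 0
    half-base-step m = begin
      X ⊛ half m 0 ⊕ Y ⊛ pow S (suc m)
        ≈⟨ +-cong (X-half m 0) (*-congʳ (sym (*-identityʳ Y))) ⟩
      pow Y 1 ⊛ Σ ⊕ pow Y 1 ⊛ pow S (suc m) ≈⟨ distribˡ _ _ _ ⟨
      pow Y 1 ⊛ (Σ ⊕ pow S (suc m))         ≈⟨ *-congˡ (+-comm _ _) ⟩
      pow Y 1 ⊛ (pow S (suc m) ⊕ Σ)
        ≈⟨ *-congˡ (+-cong (sym (term-head 0 (suc m))) (sumTo-cong (term-zero-suc m) m)) ⟩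
      pow Y 1 ⊛ (term 0 (suc m) 0 ⊕ sumTo m (λ k → term 0 (suc m) (suc k)))
        ≈⟨ *-congˡ (sumTo-head _ m) ⟨
      half (suc m) 0 ∎
      where
      Σ = sumTo m (λ k → pow q' 1 ⊛ (X ⊛ term 0 m k))

    pow-half-base : ∀ m → pow S (suc m) ≈ half m 0 ⊕ pow X (suc m)
    pow-half-base zero = begin
      S ⊛ 1#                ≈⟨ *-congʳ S≈X+Y ⟩
      (X ⊕ Y) ⊛ 1#          ≈⟨ distribʳ 1# X Y ⟩
      pow X 1 ⊕ pow Y 1     ≈⟨ +-comm _ _ ⟩
      pow Y 1 ⊕ pow X 1     ≈⟨ +-congʳ (half-zero 0) ⟨
      half 0 0 ⊕ pow X 1    ∎
    pow-half-base (suc m) = begin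
      S ⊛ Sᵐ⁺¹                                   ≈⟨ *-congʳ S≈X+Y ⟩
      (X ⊕ Y) ⊛ Sᵐ⁺¹                             ≈⟨ distribʳ _ _ _ ⟩
      X ⊛ Sᵐ⁺¹ ⊕ Y ⊛ Sᵐ⁺¹                        ≈⟨ +-congʳ (*-congˡ (pow-half-base m)) ⟩
      X ⊛ (half m 0 ⊕ pow X (suc m)) ⊕ Y ⊛ Sᵐ⁺¹  ≈⟨ +-congʳ (distribˡ _ _ _) ⟩
      (X ⊛ half m 0 ⊕ pow X (2 + m)) ⊕ Y ⊛ Sᵐ⁺¹  ≈⟨ xy∙z≈xz∙y _ _ _ ⟩
      (X ⊛ half m 0 ⊕ Y ⊛ Sᵐ⁺¹) ⊕ pow X (2 + m)  ≈⟨ +-congʳ (half-base-step m) ⟩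
      half (suc m) 0 ⊕ pow X (2 + m)             ∎
      where
      Sᵐ⁺¹ = pow S (suc m)

  module TwoSided (q q' X Y : Carrier) (qq'≈1 : q ⊛ q' ≈ 1#) (q'q≈1 : q' ⊛ q ≈ 1#)
                  (q-central : Central q) (YX≈qXY : Y ⊛ X ≈ q ⊛ (X ⊛ Y)) where

    private
      q'-central = inverse-central qq'≈1 q'q≈1 q-central
      S = X ⊕ Y

    module Xs = Expansion q q' X Y S qq'≈1 q-central q'-central (flip-commutation q'q≈1 YX≈qXY) refl
    module Ys = Expansion q' q Y X S q'q≈1 q'-central q-central YX≈qXY (+-comm X Y)

    expansion : ∀ m n → pow S (m + n + 1) ≈ Xs.half m n ⊕ Ys.half n m
    expansion m zero = begin
      pow S (m + 0 + 1)        ≈⟨ pow-congʳ S (≡.trans (ℕ.+-comm (m + 0) 1) (≡.cong suc (ℕ.+-identityʳ m))) ⟩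
      pow S (suc m)            ≈⟨ Xs.pow-half-base m ⟩
      Xs.half m 0 ⊕ pow X (suc m) ≈⟨ +-congˡ (Ys.half-zero m) ⟨
      Xs.half m 0 ⊕ Ys.half 0 m ∎
    expansion zero (suc n) = begin
      pow S (suc n + 1)             ≈⟨ pow-congʳ S (ℕ.+-comm (suc n) 1) ⟩
      pow S (2 + n)                 ≈⟨ Ys.pow-half-base (suc n) ⟩
      Ys.half (suc n) 0 ⊕ pow Y (2 + n) ≈⟨ +-comm _ _ ⟩
      pow Y (2 + n) ⊕ Ys.half (suc n) 0 ≈⟨ +-congʳ (Xs.half-zero (suc n)) ⟨
      Xs.half 0 (suc n) ⊕ Ys.half (suc n) 0 ∎
    expansion (suc m) (suc n) = begin
      S ⊛ P                                                       ≈⟨ distribʳ P X Y ⟩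
      X ⊛ P ⊕ Y ⊛ P
        ≈⟨ +-cong (*-congˡ (expansion m (suc n))) (*-congˡ (trans P≈P' (expansion (suc m) n))) ⟩
      X ⊛ (Xs.half m (suc n) ⊕ Ys.half (suc n) m) ⊕ Y ⊛ (Xs.half (suc m) n ⊕ Ys.half n (suc m))
        ≈⟨ +-cong (distribˡ _ _ _) (distribˡ _ _ _) ⟩
      (X ⊛ Xs.half m (suc n) ⊕ X ⊛ Ys.half (suc n) m) ⊕ (Y ⊛ Xs.half (suc m) n ⊕ Y ⊛ Ys.half n (suc m))
        ≈⟨ interchange _ _ _ _ ⟩
      (X ⊛ Xs.half m (suc n) ⊕ Y ⊛ Xs.half (suc m) n) ⊕ (X ⊛ Ys.half (suc n) m ⊕ Y ⊛ Ys.half n (suc m))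
        ≈⟨ +-cong (Xs.half-step m n) (trans (+-comm _ _) (Ys.half-step n m)) ⟩
      Xs.half (suc m) (suc n) ⊕ Ys.half (suc n) (suc m) ∎
      where
      P = pow S (m + suc n + 1)
      P≈P' : P ≈ pow S (suc m + n + 1)
      P≈P' = pow-congʳ S (≡.cong (_+ 1) (ℕ.+-suc m n))

mainTheorem5 : ∀ {c ℓ : Level} (R : Ring c ℓ) →
    let open RingDefs R in (q q⁻¹ : Carrier) → q ⊛ q⁻¹ ≈ 1# → q⁻¹ ⊛ q ≈ 1# →
       (∀ z → q ⊛ z ≈ z ⊛ q) →
       (X Y : Carrier) → Y ⊛ X ≈ q ⊛ (X ⊛ Y) →
       (m n : ℕ) →
       pow (X ⊕ Y) (m + n + 1)
         ≈ (pow Y (n + 1) ⊛ sumTo m (λ k → qbin q (n + k) k ⊛ (pow q⁻¹ ((n + 1) * k) ⊛ (pow X k ⊛ pow (X ⊕ Y) (m ∸ k)))))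
           ⊕ (pow X (m + 1) ⊛ sumTo n (λ k → qbin q⁻¹ (m + k) k ⊛ (pow q ((m + 1) * k) ⊛ (pow Y k ⊛ pow (X ⊕ Y) (n ∸ k)))))
mainTheorem5 R q q⁻¹ qq⁻¹≈1 q⁻¹q≈1 q-central X Y YX≈qXY =
  RingLemmas.TwoSided.expansion R q q⁻¹ X Y qq⁻¹≈1 q⁻¹q≈1 q-central YX≈qXY
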